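{- Let $K$ be a real quadratic number field with a $\mathbb{Z}$-basis $\beta_1,\beta_2\in\mathfrak{O}_K^+$ of $\mathfrak{O}_K$, and suppose $\alpha=a_2\beta_2-a_1\beta_1\in\mathfrak{O}_K^+$, where $a_1,a_2\in\mathbb{N}$ are nonzero. Then $$C_\mathbb{Q}(\beta_1,\beta_2,\alpha)\cap\mathfrak{O}_K=\Big\{y_1\beta_1+y_2\beta_2\ \Big|\ y_1,y_2\in\mathbb{Z},\ y_2\geqslant0,\ y_2\geqslant-\tfrac{a_2}{a_1}y_1\Big\}.$$
   Context: A real quadratic number field is a degree-2 number field contained in $\mathbb{R}$; $\mathfrak{O}_K$ is its ring of integers and $\mathfrak{O}_K^+=\mathfrak{O}_K\cap[0,\infty)$. $\mathbb{N}=\{0,1,2,\dots\}$. $C_\mathbb{Q}(\gamma_1,\dots,\gamma_k)=\{\sum x_i\gamma_i\mid x_i\in\mathbb{Q}_{\geqslant0}\}$. -}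

module Defs where

open import Data.Nat as ℕ using (ℕ)
open import Data.Integer as ℤ using (ℤ; +_)
open import Data.Rational as ℚ using (ℚ; 0ℚ; 1ℚ; _/_)
open import Data.List using (List; []; _∷_)
open import Data.Product using (_×_; _,_; Σ; ∃; ∃-syntax)
open import Data.Sum using (_⊎_)
open import Relation.Binary.PropositionalEquality using (_≡_)
open import Relation.Nullary using (¬_)

-- d ≥ 2 and d is not a perfect square: then K = ℚ(√d) ⊂ ℝ is a real quadratic field,
-- and every real quadratic field (as a subfield of ℝ) is of this form.
RealQuadParam : ℕ → Set
RealQuadParam d = (2 ℕ.≤ d) × (¬ (∃[ k ] (k ℕ.* k ≡ d)))

-- Element a + b√d of K, represented by the pair (a , b) of rationals.
K : Set
K = ℚ × ℚ

ℤ→ℚ : ℤ → ℚ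
ℤ→ℚ z = z / 1

ℕ→ℚ : ℕ → ℚ
ℕ→ℚ n = (+ n) / 1

0K : K
0K = 0ℚ , 0ℚ

1K : K
1K = 1ℚ , 0ℚ

_⊕_ : K → K → K
(a , b) ⊕ (c , e) = (a ℚ.+ c) , (b ℚ.+ e)

mulK : ℕ → K → K → K
mulK d (a , b) (c , e) = (a ℚ.* c ℚ.+ ℕ→ℚ d ℚ.* (b ℚ.* e)) , (a ℚ.* e ℚ.+ b ℚ.* c)

_·_ : ℚ → K → K
q · (a , b) = (q ℚ.* a) , (q ℚ.* b)

_·ℤ_ : ℤ → K → K
z ·ℤ x = ℤ→ℚ z · x

powK : ℕ → K → ℕ → K
powK d x ℕ.zero = 1K
powK d x (ℕ.suc n) = mulK d x (powK d x n)

-- Evaluate the monic polynomial  X^n + c_{n-1} X^{n-1} + ... + c_0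
-- with coefficient list  cs = c_0 ∷ c_1 ∷ ... ∷ c_{n-1} ∷ []  (n = length cs).
-- evalMonicFrom d x i cs = Σ_j c_j x^(i+j) + x^(i + length cs)
evalMonicFrom : ℕ → K → ℕ → List ℤ → K
evalMonicFrom d x i [] = powK d x i
evalMonicFrom d x i (c ∷ cs) = (c ·ℤ powK d x i) ⊕ evalMonicFrom d x (ℕ.suc i) cs

evalMonic : ℕ → List ℤ → K → K
evalMonic d cs x = evalMonicFrom d x 0 cs

InO : ℕ → K → Set
InO d x = ∃[ cs ] (evalMonic d cs x ≡ 0K)

-- a + b√d ≥ 0 as a real number (√d the positive square root)
Nonneg : ℕ → K → Set
Nonneg d (a , b) =
    (0ℚ ℚ.≤ a × 0ℚ ℚ.≤ b)
  ⊎ ((0ℚ ℚ.≤ a × b ℚ.≤ 0ℚ × ℕ→ℚ d ℚ.* (b ℚ.* b) ℚ.≤ a ℚ.* a)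
  ⊎ (a ℚ.≤ 0ℚ × 0ℚ ℚ.≤ b × a ℚ.* a ℚ.≤ ℕ→ℚ d ℚ.* (b ℚ.* b)))

InOplus : ℕ → K → Set
InOplus d x = InO d x × Nonneg d x

IsZBasis : ℕ → K → K → Set
IsZBasis d β₁ β₂ =
    InO d β₁ × InO d β₂
  × ((x : K) → InO d x → ∃[ y₁ ] ∃[ y₂ ] (x ≡ (y₁ ·ℤ β₁) ⊕ (y₂ ·ℤ β₂)))
  × ((y₁ y₂ : ℤ) → (y₁ ·ℤ β₁) ⊕ (y₂ ·ℤ β₂) ≡ 0K → (y₁ ≡ + 0) × (y₂ ≡ + 0))

InCone3 : K → K → K → K → Set
InCone3 γ₁ γ₂ γ₃ x =
  ∃[ x₁ ] ∃[ x₂ ] ∃[ x₃ ]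
    (0ℚ ℚ.≤ x₁ × 0ℚ ℚ.≤ x₂ × 0ℚ ℚ.≤ x₃
     × x ≡ (x₁ · γ₁) ⊕ ((x₂ · γ₂) ⊕ (x₃ · γ₃)))

-- In the ℚ-basis β₁, β₂ of K, the cone C_ℚ(β₁, β₂, α) with α = a₂β₂ − a₁β₁ is cut out by y₂ ≥ 0 and
-- y₂ ≥ −(a₂/a₁) y₁: a point y₁β₁ + y₂β₂ with y₁ ≥ 0 has cone coordinates (y₁, y₂, 0), one with y₁ < 0
-- has (0, y₂ + (a₂/a₁) y₁, −y₁/a₁). So it remains to see that x ∈ 𝔒_K iff y₁, y₂ ∈ ℤ. One direction is
-- the basis property. For the other, a + b√d lies in 𝔒_K as soon as its trace 2a and norm a² − db² are
-- integers, and these are integers for every element of 𝔒_K: if β is a root of a monic integer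
-- polynomial, the products βⁱ β̄ʲ have a common denominator, hence so do the powers of Tr β and N β,
-- which forces them into ℤ. The norm of y₁β₁ + y₂β₂ also involves Tr(β₁ β̄₂), which is an integer by
-- a parity argument.
module Submission where

open import Defs
open import Algebra.Bundles using (CommutativeRing)
open import Data.Empty using (⊥-elim)
open import Data.Integer as ℤ using (ℤ; +_; -_; -[1+_])
import Data.Integer.DivMod as ℤD
import Data.Integer.Properties as ℤP
open import Data.Integer.Tactic.RingSolver using () renaming (solve-∀ to ℤ-solve-∀)
open import Data.List using (List; []; _∷_; length)
open import Data.Nat as ℕ using (ℕ; NonZero; zero; suc)
open import Data.Nat.Coprimality as Coprimality using (Coprime)
open import Data.Nat.Divisibility using (_∣_; divides; ∣⇒≤; ∣-trans; ∣1⇒≡1)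
open import Data.Nat.Induction using (<-rec)
import Data.Nat.Properties as ℕP
open import Data.Product using (_×_; _,_; ∃-syntax; proj₁; proj₂)
open import Data.Rational as ℚ using (ℚ; mkℚ; _/_; 0ℚ; 1ℚ)
import Data.Rational.Properties as ℚP
import Data.Rational.Unnormalised as ℚᵘ
import Data.Rational.Unnormalised.Properties as ℚᵘP
open import Data.Sum using (_⊎_; inj₁; inj₂)
open import Function.Bundles using (_⇔_; mk⇔)
open import Level using (0ℓ)
open import Relation.Binary.PropositionalEquality
open import Relation.Nullary using (yes; no)
open import Relation.Nullary.Decidable using (dec⇒maybe)
open import Tactic.RingSolver using (solve-∀)
open import Tactic.RingSolver.Core.AlmostCommutativeRing using (AlmostCommutativeRing; fromCommutativeRing)
open import Algebra.Properties.CommutativeSemiring.Exp (CommutativeRing.commutativeSemiring ℚP.+-*-commutativeRing)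
  using (_^_; ^-distrib-*)
open import Algebra.Properties.Group ℚP.+-0-group using (x∙y⁻¹≈ε⇒x≈y)

-- Without the zero test the solver cannot discard vanishing coefficients such as 0ℚ ℚ.* b.
ℚ-ring : AlmostCommutativeRing 0ℓ 0ℓ
ℚ-ring = fromCommutativeRing ℚP.+-*-commutativeRing (λ q → dec⇒maybe (0ℚ ℚP.≟ q))

-- Integers among the rationals

toℚᵘ-ℤ→ℚ : ∀ i → ℚ.toℚᵘ (ℤ→ℚ i) ℚᵘ.≃ ℚᵘ.mkℚᵘ i 0
toℚᵘ-ℤ→ℚ i = ℚP.toℚᵘ-fromℚᵘ (ℚᵘ.mkℚᵘ i 0)

≡ℤ→ℚ : ∀ {q} i → ℚ.toℚᵘ q ℚᵘ.≃ ℚᵘ.mkℚᵘ i 0 → q ≡ ℤ→ℚ i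
≡ℤ→ℚ {q} i q≃i = trans (sym (ℚP.fromℚᵘ-toℚᵘ q)) (ℚP.fromℚᵘ-cong q≃i)

ℤ→ℚ-homo-+ : ∀ i j → ℤ→ℚ (i ℤ.+ j) ≡ ℤ→ℚ i ℚ.+ ℤ→ℚ j
ℤ→ℚ-homo-+ i j = sym (≡ℤ→ℚ (i ℤ.+ j) (ℚᵘP.≃-trans (ℚP.toℚᵘ-homo-+ (ℤ→ℚ i) (ℤ→ℚ j))
  (ℚᵘP.≃-trans (ℚᵘP.+-cong (toℚᵘ-ℤ→ℚ i) (toℚᵘ-ℤ→ℚ j)) (ℚᵘ.*≡* (cross i j)))))
  where
  cross : ∀ i j → (i ℤ.* + 1 ℤ.+ j ℤ.* + 1) ℤ.* + 1 ≡ (i ℤ.+ j) ℤ.* (+ 1 ℤ.* + 1)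
  cross = ℤ-solve-∀

ℤ→ℚ-homo-* : ∀ i j → ℤ→ℚ (i ℤ.* j) ≡ ℤ→ℚ i ℚ.* ℤ→ℚ j
ℤ→ℚ-homo-* i j = sym (≡ℤ→ℚ (i ℤ.* j) (ℚᵘP.≃-trans (ℚP.toℚᵘ-homo-* (ℤ→ℚ i) (ℤ→ℚ j))
  (ℚᵘP.≃-trans (ℚᵘP.*-cong (toℚᵘ-ℤ→ℚ i) (toℚᵘ-ℤ→ℚ j)) (ℚᵘ.*≡* refl))))

ℤ→ℚ-homo‿- : ∀ i → ℤ→ℚ (- i) ≡ ℚ.- ℤ→ℚ i
ℤ→ℚ-homo‿- i = sym (≡ℤ→ℚ (- i) (ℚᵘP.≃-trans (ℚP.toℚᵘ-homo‿- (ℤ→ℚ i))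
  (ℚᵘP.≃-trans (ℚᵘP.-‿cong (toℚᵘ-ℤ→ℚ i)) (ℚᵘ.*≡* refl))))

ℤ→ℚ-injective : ∀ {i j} → ℤ→ℚ i ≡ ℤ→ℚ j → i ≡ j
ℤ→ℚ-injective {i} {j} eq = trans (sym (ℤP.*-identityʳ i)) (trans (ℚᵘP.drop-*≡* i≃j) (ℤP.*-identityʳ j))
  where
  i≃j : ℚᵘ.mkℚᵘ i 0 ℚᵘ.≃ ℚᵘ.mkℚᵘ j 0
  i≃j = ℚᵘP.≃-trans (ℚᵘP.≃-sym (toℚᵘ-ℤ→ℚ i)) (ℚᵘP.≃-trans (ℚP.toℚᵘ-cong eq) (toℚᵘ-ℤ→ℚ j))

ℤ→ℚ-homo-^ : ∀ i k → ℤ→ℚ (i ℤ.^ k) ≡ ℤ→ℚ i ^ k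
ℤ→ℚ-homo-^ i zero = refl
ℤ→ℚ-homo-^ i (suc k) = trans (ℤ→ℚ-homo-* i (i ℤ.^ k)) (cong (ℤ→ℚ i ℚ.*_) (ℤ→ℚ-homo-^ i k))

↧ₙ*≡↥ : ∀ q → ℕ→ℚ (ℚ.↧ₙ q) ℚ.* q ≡ ℤ→ℚ (ℚ.↥ q)
↧ₙ*≡↥ q@(mkℚ n e _) = ≡ℤ→ℚ {ℕ→ℚ (suc e) ℚ.* q} n (ℚᵘP.≃-trans (ℚP.toℚᵘ-homo-* (ℕ→ℚ (suc e)) q)
  (ℚᵘP.≃-trans (ℚᵘP.*-congʳ (toℚᵘ-ℤ→ℚ (+ suc e))) (ℚᵘ.*≡* (cross e n))))
  where
  commute : ∀ s n → (s ℤ.* n) ℤ.* + 1 ≡ n ℤ.* s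
  commute = ℤ-solve-∀
  cross : ∀ e n → (+ suc e ℤ.* n) ℤ.* + 1 ≡ n ℤ.* + suc (e ℕ.+ 0)
  cross e n rewrite ℕP.+-identityʳ e = commute (+ suc e) n

Intℚ : ℚ → Set
Intℚ q = ∃[ i ] ℤ→ℚ i ≡ q

Intℚ-+ : ∀ {p q} → Intℚ p → Intℚ q → Intℚ (p ℚ.+ q)
Intℚ-+ (i , refl) (j , refl) = i ℤ.+ j , ℤ→ℚ-homo-+ i j

Intℚ-* : ∀ {p q} → Intℚ p → Intℚ q → Intℚ (p ℚ.* q)
Intℚ-* (i , refl) (j , refl) = i ℤ.* j , ℤ→ℚ-homo-* i j

Intℚ-neg : ∀ {p} → Intℚ p → Intℚ (ℚ.- p)
Intℚ-neg (i , refl) = - i , ℤ→ℚ-homo‿- i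

abs-^ : ∀ i k → ℤ.∣ i ℤ.^ k ∣ ≡ ℤ.∣ i ∣ ℕ.^ k
abs-^ i zero = refl
abs-^ i (suc k) = trans (ℤP.abs-* i (i ℤ.^ k)) (cong (ℤ.∣ i ∣ ℕ.*_) (abs-^ i k))

coprime-*ʳ : ∀ {m n o} → Coprime m n → Coprime m o → Coprime m (n ℕ.* o)
coprime-*ʳ cop-mn cop-mo (i∣m , i∣no) =
  cop-mo (i∣m , Coprimality.coprime-divisor (λ (j∣i , j∣n) → cop-mn (∣-trans j∣i i∣m , j∣n)) i∣no)

coprime-^ʳ : ∀ {m n} k → Coprime m n → Coprime m (n ℕ.^ k)
coprime-^ʳ zero _ (_ , i∣1) = ∣1⇒≡1 i∣1
coprime-^ʳ (suc k) c = coprime-*ʳ c (coprime-^ʳ k c)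

coprime-^ : ∀ {m n} k → Coprime m n → Coprime (m ℕ.^ k) (n ℕ.^ k)
coprime-^ k c = coprime-^ʳ k (Coprimality.sym (coprime-^ʳ k (Coprimality.sym c)))

n<m^n : ∀ {m} → 2 ℕ.≤ m → ∀ n → n ℕ.< m ℕ.^ n
n<m^n 2≤m zero = ℕ.s≤s ℕ.z≤n
n<m^n {m} 2≤m (suc n) = begin-strict
  suc n               ≤⟨ n<m^n 2≤m n ⟩
  m ℕ.^ n             <⟨ ℕP.m<m+n (m ℕ.^ n) (ℕP.≤-<-trans ℕ.z≤n (n<m^n 2≤m n)) ⟩
  m ℕ.^ n ℕ.+ m ℕ.^ n ≡⟨ cong (m ℕ.^ n ℕ.+_) (sym (ℕP.+-identityʳ (m ℕ.^ n))) ⟩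
  2 ℕ.* m ℕ.^ n       ≤⟨ ℕP.*-monoˡ-≤ (m ℕ.^ n) 2≤m ⟩
  m ℕ.* m ℕ.^ n       ∎
  where open ℕP.≤-Reasoning

denominator-power : ∀ M q k {z} → ℤ→ℚ z ≡ ℕ→ℚ M ℚ.* q ^ k →
                    z ℤ.* (+ ℚ.↧ₙ q) ℤ.^ k ≡ + M ℤ.* ℚ.↥ q ℤ.^ k
denominator-power M q k {z} z≡Mqᵏ = ℤ→ℚ-injective (begin
  ℤ→ℚ (z ℤ.* s ℤ.^ k)                 ≡⟨ ℤ→ℚ-homo-* z (s ℤ.^ k) ⟩
  ℤ→ℚ z ℚ.* ℤ→ℚ (s ℤ.^ k)             ≡⟨ cong₂ ℚ._*_ z≡Mqᵏ (ℤ→ℚ-homo-^ s k) ⟩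
  (ℕ→ℚ M ℚ.* q ^ k) ℚ.* ℤ→ℚ s ^ k     ≡⟨ regroup (ℕ→ℚ M) (q ^ k) (ℤ→ℚ s ^ k) ⟩
  ℕ→ℚ M ℚ.* (ℤ→ℚ s ^ k ℚ.* q ^ k)     ≡⟨ cong (ℕ→ℚ M ℚ.*_) (sym (^-distrib-* (ℤ→ℚ s) q k)) ⟩
  ℕ→ℚ M ℚ.* (ℤ→ℚ s ℚ.* q) ^ k         ≡⟨ cong (λ r → ℕ→ℚ M ℚ.* r ^ k) (↧ₙ*≡↥ q) ⟩
  ℕ→ℚ M ℚ.* ℤ→ℚ (ℚ.↥ q) ^ k           ≡⟨ cong (ℕ→ℚ M ℚ.*_) (sym (ℤ→ℚ-homo-^ (ℚ.↥ q) k)) ⟩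
  ℕ→ℚ M ℚ.* ℤ→ℚ (ℚ.↥ q ℤ.^ k)         ≡⟨ sym (ℤ→ℚ-homo-* (+ M) (ℚ.↥ q ℤ.^ k)) ⟩
  ℤ→ℚ (+ M ℤ.* ℚ.↥ q ℤ.^ k)           ∎)
  where
  open ≡-Reasoning
  s = + ℚ.↧ₙ q
  regroup : ∀ a b c → (a ℚ.* b) ℚ.* c ≡ a ℚ.* (c ℚ.* b)
  regroup = solve-∀ ℚ-ring

-- If q = n/s in lowest terms with s ≥ 2, then s^M ∣ M·n^M and gcd(s, n) = 1 force s^M ∣ M,
-- contradicting M < s^M.
bounded-powers⇒Intℚ : ∀ M .{{_ : NonZero M}} q → (∀ k → Intℚ (ℕ→ℚ M ℚ.* q ^ k)) → Intℚ q
bounded-powers⇒Intℚ M q@(mkℚ n zero _) _ = n , ℚP.↥p/↧p≡p q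
bounded-powers⇒Intℚ M q@(mkℚ n (suc e) cop) bounded =
  ⊥-elim (ℕP.<⇒≱ (n<m^n (ℕ.s≤s (ℕ.s≤s ℕ.z≤n)) M) (∣⇒≤ sᴹ∣M))
  where
  s = suc (suc e)
  z = proj₁ (bounded M)
  cross : ℤ.∣ n ∣ ℕ.^ M ℕ.* M ≡ ℤ.∣ z ∣ ℕ.* s ℕ.^ M
  cross = begin
    ℤ.∣ n ∣ ℕ.^ M ℕ.* M              ≡⟨ ℕP.*-comm (ℤ.∣ n ∣ ℕ.^ M) M ⟩
    M ℕ.* ℤ.∣ n ∣ ℕ.^ M              ≡⟨ cong (M ℕ.*_) (sym (abs-^ n M)) ⟩
    M ℕ.* ℤ.∣ n ℤ.^ M ∣              ≡⟨ sym (ℤP.abs-* (+ M) (n ℤ.^ M)) ⟩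
    ℤ.∣ + M ℤ.* n ℤ.^ M ∣            ≡⟨ cong ℤ.∣_∣ (sym (denominator-power M q M {z} (proj₂ (bounded M)))) ⟩
    ℤ.∣ z ℤ.* (+ s) ℤ.^ M ∣          ≡⟨ ℤP.abs-* z ((+ s) ℤ.^ M) ⟩
    ℤ.∣ z ∣ ℕ.* ℤ.∣ (+ s) ℤ.^ M ∣    ≡⟨ cong (ℤ.∣ z ∣ ℕ.*_) (abs-^ (+ s) M) ⟩
    ℤ.∣ z ∣ ℕ.* s ℕ.^ M              ∎
    where open ≡-Reasoning
  sᴹ∣M : s ℕ.^ M ∣ M
  sᴹ∣M = Coprimality.coprime-divisor (coprime-^ M (Coprimality.sym (Coprimality.recompute cop))) (divides ℤ.∣ z ∣ cross)

-- Arithmetic in K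

⊕-assoc : ∀ x y z → (x ⊕ y) ⊕ z ≡ x ⊕ (y ⊕ z)
⊕-assoc (a , b) (c , e) (f , g) = cong₂ _,_ (ℚP.+-assoc a c f) (ℚP.+-assoc b e g)

⊕-identityˡ : ∀ x → 0K ⊕ x ≡ x
⊕-identityˡ (a , b) = cong₂ _,_ (ℚP.+-identityˡ a) (ℚP.+-identityˡ b)

⊕≡0K⇒≡-1· : ∀ x y → x ⊕ y ≡ 0K → y ≡ (ℚ.- 1ℚ) · x
⊕≡0K⇒≡-1· (a , b) (c , e) x⊕y≡0 = cong₂ _,_ (component a c (cong proj₁ x⊕y≡0)) (component b e (cong proj₂ x⊕y≡0))
  where
  shift : ∀ a c → c ≡ (a ℚ.+ c) ℚ.- a
  shift = solve-∀ ℚ-ring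
  negate : ∀ a → 0ℚ ℚ.- a ≡ ℚ.- 1ℚ ℚ.* a
  negate = solve-∀ ℚ-ring
  component : ∀ a c → a ℚ.+ c ≡ 0ℚ → c ≡ ℚ.- 1ℚ ℚ.* a
  component a c a+c≡0 = trans (shift a c) (trans (cong (ℚ._- a) a+c≡0) (negate a))

·-distrib-⊕ : ∀ q x y → q · (x ⊕ y) ≡ (q · x) ⊕ (q · y)
·-distrib-⊕ q (a , b) (c , e) = cong₂ _,_ (ℚP.*-distribˡ-+ q a c) (ℚP.*-distribˡ-+ q b e)

·-assoc : ∀ q r x → q · (r · x) ≡ (q ℚ.* r) · x
·-assoc q r (a , b) = cong₂ _,_ (sym (ℚP.*-assoc q r a)) (sym (ℚP.*-assoc q r b))

·-comm : ∀ q r x → q · (r · x) ≡ r · (q · x)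
·-comm q r x = trans (·-assoc q r x) (trans (cong (_· x) (ℚP.*-comm q r)) (sym (·-assoc r q x)))

·-zeroʳ : ∀ q → q · 0K ≡ 0K
·-zeroʳ q = cong₂ _,_ (ℚP.*-zeroʳ q) (ℚP.*-zeroʳ q)

module _ (d : ℕ) where

  private
    n = ℕ→ℚ d

  mulK-comm : ∀ x y → mulK d x y ≡ mulK d y x
  mulK-comm (a , b) (c , e) = cong₂ _,_ (re₁ n a b c e) (re₂ a b c e)
    where
    re₁ : ∀ n a b c e → a ℚ.* c ℚ.+ n ℚ.* (b ℚ.* e) ≡ c ℚ.* a ℚ.+ n ℚ.* (e ℚ.* b)
    re₁ = solve-∀ ℚ-ring
    re₂ : ∀ a b c e → a ℚ.* e ℚ.+ b ℚ.* c ≡ c ℚ.* b ℚ.+ e ℚ.* a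
    re₂ = solve-∀ ℚ-ring

  mulK-assoc : ∀ x y z → mulK d (mulK d x y) z ≡ mulK d x (mulK d y z)
  mulK-assoc (a , b) (c , e) (f , g) = cong₂ _,_ (re₁ n a b c e f g) (re₂ n a b c e f g)
    where
    re₁ : ∀ n a b c e f g → (a ℚ.* c ℚ.+ n ℚ.* (b ℚ.* e)) ℚ.* f ℚ.+ n ℚ.* ((a ℚ.* e ℚ.+ b ℚ.* c) ℚ.* g)
                          ≡ a ℚ.* (c ℚ.* f ℚ.+ n ℚ.* (e ℚ.* g)) ℚ.+ n ℚ.* (b ℚ.* (c ℚ.* g ℚ.+ e ℚ.* f))
    re₁ = solve-∀ ℚ-ring
    re₂ : ∀ n a b c e f g → (a ℚ.* c ℚ.+ n ℚ.* (b ℚ.* e)) ℚ.* g ℚ.+ (a ℚ.* e ℚ.+ b ℚ.* c) ℚ.* f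
                          ≡ a ℚ.* (c ℚ.* g ℚ.+ e ℚ.* f) ℚ.+ b ℚ.* (c ℚ.* f ℚ.+ n ℚ.* (e ℚ.* g))
    re₂ = solve-∀ ℚ-ring

  mulK-distribˡ-⊕ : ∀ x y z → mulK d x (y ⊕ z) ≡ mulK d x y ⊕ mulK d x z
  mulK-distribˡ-⊕ (a , b) (c , e) (f , g) = cong₂ _,_ (re₁ n a b c e f g) (re₂ a b c e f g)
    where
    re₁ : ∀ n a b c e f g → a ℚ.* (c ℚ.+ f) ℚ.+ n ℚ.* (b ℚ.* (e ℚ.+ g))
                          ≡ (a ℚ.* c ℚ.+ n ℚ.* (b ℚ.* e)) ℚ.+ (a ℚ.* f ℚ.+ n ℚ.* (b ℚ.* g))
    re₁ = solve-∀ ℚ-ring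
    re₂ : ∀ a b c e f g → a ℚ.* (e ℚ.+ g) ℚ.+ b ℚ.* (c ℚ.+ f) ≡ (a ℚ.* e ℚ.+ b ℚ.* c) ℚ.+ (a ℚ.* g ℚ.+ b ℚ.* f)
    re₂ = solve-∀ ℚ-ring

  mulK-distribʳ-⊕ : ∀ x y z → mulK d (y ⊕ z) x ≡ mulK d y x ⊕ mulK d z x
  mulK-distribʳ-⊕ x y z = trans (mulK-comm (y ⊕ z) x)
    (trans (mulK-distribˡ-⊕ x y z) (cong₂ _⊕_ (mulK-comm x y) (mulK-comm x z)))

  mulK-identityˡ : ∀ x → mulK d 1K x ≡ x
  mulK-identityˡ (a , b) = cong₂ _,_ (re₁ n a b) (re₂ a b)
    where
    re₁ : ∀ n a b → 1ℚ ℚ.* a ℚ.+ n ℚ.* (0ℚ ℚ.* b) ≡ a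
    re₁ = solve-∀ ℚ-ring
    re₂ : ∀ a b → 1ℚ ℚ.* b ℚ.+ 0ℚ ℚ.* a ≡ b
    re₂ = solve-∀ ℚ-ring

  mulK-zeroʳ : ∀ x → mulK d x 0K ≡ 0K
  mulK-zeroʳ (a , b) = cong₂ _,_ (re₁ n a b) (re₂ a b)
    where
    re₁ : ∀ n a b → a ℚ.* 0ℚ ℚ.+ n ℚ.* (b ℚ.* 0ℚ) ≡ 0ℚ
    re₁ = solve-∀ ℚ-ring
    re₂ : ∀ a b → a ℚ.* 0ℚ ℚ.+ b ℚ.* 0ℚ ≡ 0ℚ
    re₂ = solve-∀ ℚ-ring

  mulK-·ˡ : ∀ q x y → mulK d (q · x) y ≡ q · mulK d x y
  mulK-·ˡ q (a , b) (c , e) = cong₂ _,_ (re₁ n q a b c e) (re₂ q a b c e)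
    where
    re₁ : ∀ n q a b c e → (q ℚ.* a) ℚ.* c ℚ.+ n ℚ.* ((q ℚ.* b) ℚ.* e) ≡ q ℚ.* (a ℚ.* c ℚ.+ n ℚ.* (b ℚ.* e))
    re₁ = solve-∀ ℚ-ring
    re₂ : ∀ q a b c e → (q ℚ.* a) ℚ.* e ℚ.+ (q ℚ.* b) ℚ.* c ≡ q ℚ.* (a ℚ.* e ℚ.+ b ℚ.* c)
    re₂ = solve-∀ ℚ-ring

  mulK-·ʳ : ∀ q x y → mulK d x (q · y) ≡ q · mulK d x y
  mulK-·ʳ q x y = trans (mulK-comm x (q · y)) (trans (mulK-·ˡ q y x) (cong (q ·_) (mulK-comm y x)))

conjK : K → K
conjK (a , b) = a , ℚ.- b

conjK-mulK : ∀ d x y → conjK (mulK d x y) ≡ mulK d (conjK x) (conjK y)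
conjK-mulK d (a , b) (c , e) = cong₂ _,_ (re₁ (ℕ→ℚ d) a b c e) (re₂ a b c e)
  where
  re₁ : ∀ n a b c e → a ℚ.* c ℚ.+ n ℚ.* (b ℚ.* e) ≡ a ℚ.* c ℚ.+ n ℚ.* ((ℚ.- b) ℚ.* (ℚ.- e))
  re₁ = solve-∀ ℚ-ring
  re₂ : ∀ a b c e → ℚ.- (a ℚ.* e ℚ.+ b ℚ.* c) ≡ a ℚ.* (ℚ.- e) ℚ.+ (ℚ.- b) ℚ.* c
  re₂ = solve-∀ ℚ-ring

conjK-powK : ∀ d x k → conjK (powK d x k) ≡ powK d (conjK x) k
conjK-powK d x ℕ.zero = refl
conjK-powK d x (ℕ.suc k) = trans (conjK-mulK d x (powK d x k)) (cong (mulK d (conjK x)) (conjK-powK d x k))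

conjK-· : ∀ q x → conjK (q · x) ≡ q · conjK x
conjK-· q (a , b) = cong (q ℚ.* a ,_) (ℚP.neg-distribʳ-* q b)

ℕ→ℚ-homo-* : ∀ m n → ℕ→ℚ (m ℕ.* n) ≡ ℕ→ℚ m ℚ.* ℕ→ℚ n
ℕ→ℚ-homo-* m n = trans (cong ℤ→ℚ (ℤP.pos-* m n)) (ℤ→ℚ-homo-* (+ m) (+ n))

Intℚ-ℕ* : ∀ k {m q} → Intℚ (ℕ→ℚ m ℚ.* q) → Intℚ (ℕ→ℚ (k ℕ.* m) ℚ.* q)
Intℚ-ℕ* k {m} {q} int = subst Intℚ (sym (trans (cong (ℚ._* q) (ℕ→ℚ-homo-* k m)) (ℚP.*-assoc (ℕ→ℚ k) (ℕ→ℚ m) q)))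
  (Intℚ-* (+ k , refl) int)

IntK : K → Set
IntK (a , b) = Intℚ a × Intℚ b

IntK-⊕ : ∀ {x y} → IntK x → IntK y → IntK (x ⊕ y)
IntK-⊕ (a , b) (c , e) = Intℚ-+ a c , Intℚ-+ b e

IntK-·ℤ : ∀ i {x} → IntK x → IntK (i ·ℤ x)
IntK-·ℤ i (a , b) = Intℚ-* (i , refl) a , Intℚ-* (i , refl) b

IntK-mulK : ∀ d {x y} → IntK x → IntK y → IntK (mulK d x y)
IntK-mulK d (a , b) (c , e) = Intℚ-+ (Intℚ-* a c) (Intℚ-* (+ d , refl) (Intℚ-* b e)) , Intℚ-+ (Intℚ-* a e) (Intℚ-* b c)

IntK-conjK : ∀ {x} → IntK x → IntK (conjK x)
IntK-conjK (a , b) = a , Intℚ-neg b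

IntK-ℕ· : ∀ k {m} x → IntK (ℕ→ℚ m · x) → IntK (ℕ→ℚ (k ℕ.* m) · x)
IntK-ℕ· k x (a , b) = Intℚ-ℕ* k a , Intℚ-ℕ* k b

denominatorK : ∀ x → ∃[ D ] (NonZero D × IntK (ℕ→ℚ D · x))
denominatorK (a , b) = ℚ.↧ₙ a ℕ.* ℚ.↧ₙ b , ℕP.m*n≢0 (ℚ.↧ₙ a) (ℚ.↧ₙ b) ,
  subst (λ D → Intℚ (ℕ→ℚ D ℚ.* a)) (ℕP.*-comm (ℚ.↧ₙ b) (ℚ.↧ₙ a)) (Intℚ-ℕ* (ℚ.↧ₙ b) {ℚ.↧ₙ a} (ℚ.↥ a , sym (↧ₙ*≡↥ a))) ,
  Intℚ-ℕ* (ℚ.↧ₙ a) {ℚ.↧ₙ b} (ℚ.↥ b , sym (↧ₙ*≡↥ b))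

common-denominator : (f : ℕ → K) → ∀ m → ∃[ D ] (NonZero D × (∀ {j} → j ℕ.< m → IntK (ℕ→ℚ D · f j)))
common-denominator f zero = 1 , _ , λ ()
common-denominator f (suc m) = extend (common-denominator f m) (denominatorK (f m))
  where
  extend : ∃[ D ] (NonZero D × (∀ {j} → j ℕ.< m → IntK (ℕ→ℚ D · f j))) → ∃[ E ] (NonZero E × IntK (ℕ→ℚ E · f m)) →
           ∃[ D ] (NonZero D × (∀ {j} → j ℕ.< suc m → IntK (ℕ→ℚ D · f j)))
  extend (D , D≢0 , below-m) (E , E≢0 , at-m) = E ℕ.* D , ℕP.m*n≢0 E D {{E≢0}} {{D≢0}} , λ j<1+m → below (ℕP.m<1+n⇒m<n∨m≡n j<1+m)
    where
    below : ∀ {j} → j ℕ.< m ⊎ j ≡ m → IntK (ℕ→ℚ (E ℕ.* D) · f j)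
    below (inj₁ j<m) = IntK-ℕ· E (f _) (below-m j<m)
    below (inj₂ refl) = subst (λ D′ → IntK (ℕ→ℚ D′ · f m)) (ℕP.*-comm D E) (IntK-ℕ· D (f m) at-m)

module PowersOfRoot (d : ℕ) (x : K) (cs : List ℤ) (root : evalMonic d cs x ≡ 0K) where

  xᵏ : ℕ → K
  xᵏ = powK d x

  powK-+ : ∀ i j → xᵏ (i ℕ.+ j) ≡ mulK d (xᵏ i) (xᵏ j)
  powK-+ zero j = sym (mulK-identityˡ d (xᵏ j))
  powK-+ (suc i) j = trans (cong (mulK d x) (powK-+ i j)) (sym (mulK-assoc d x (xᵏ i) (xᵏ j)))

  lowerTerms : ℕ → List ℤ → K
  lowerTerms i [] = 0K
  lowerTerms i (c ∷ cs) = (c ·ℤ xᵏ i) ⊕ lowerTerms (suc i) cs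

  evalMonicFrom-split : ∀ i cs → evalMonicFrom d x i cs ≡ lowerTerms i cs ⊕ xᵏ (i ℕ.+ length cs)
  evalMonicFrom-split i [] = trans (cong xᵏ (sym (ℕP.+-identityʳ i))) (sym (⊕-identityˡ _))
  evalMonicFrom-split i (c ∷ cs) = begin
    (c ·ℤ xᵏ i) ⊕ evalMonicFrom d x (suc i) cs
      ≡⟨ cong ((c ·ℤ xᵏ i) ⊕_) (evalMonicFrom-split (suc i) cs) ⟩
    (c ·ℤ xᵏ i) ⊕ (lowerTerms (suc i) cs ⊕ xᵏ (suc i ℕ.+ length cs))
      ≡⟨ cong (λ k → (c ·ℤ xᵏ i) ⊕ (lowerTerms (suc i) cs ⊕ xᵏ k)) (sym (ℕP.+-suc i (length cs))) ⟩
    (c ·ℤ xᵏ i) ⊕ (lowerTerms (suc i) cs ⊕ xᵏ (i ℕ.+ suc (length cs)))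
      ≡⟨ sym (⊕-assoc (c ·ℤ xᵏ i) (lowerTerms (suc i) cs) _) ⟩
    lowerTerms i (c ∷ cs) ⊕ xᵏ (i ℕ.+ length (c ∷ cs))
      ∎
    where open ≡-Reasoning

  evalMonicFrom-shift : ∀ i j cs → evalMonicFrom d x (i ℕ.+ j) cs ≡ mulK d (xᵏ i) (evalMonicFrom d x j cs)
  evalMonicFrom-shift i j [] = powK-+ i j
  evalMonicFrom-shift i j (c ∷ cs) = begin
    (c ·ℤ xᵏ (i ℕ.+ j)) ⊕ evalMonicFrom d x (suc (i ℕ.+ j)) cs
      ≡⟨ cong₂ _⊕_ (cong (c ·ℤ_) (powK-+ i j)) (cong (λ k → evalMonicFrom d x k cs) (sym (ℕP.+-suc i j))) ⟩
    (c ·ℤ mulK d (xᵏ i) (xᵏ j)) ⊕ evalMonicFrom d x (i ℕ.+ suc j) cs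
      ≡⟨ cong₂ _⊕_ (sym (mulK-·ʳ d (ℤ→ℚ c) (xᵏ i) (xᵏ j))) (evalMonicFrom-shift i (suc j) cs) ⟩
    mulK d (xᵏ i) (c ·ℤ xᵏ j) ⊕ mulK d (xᵏ i) (evalMonicFrom d x (suc j) cs)
      ≡⟨ sym (mulK-distribˡ-⊕ d (xᵏ i) _ _) ⟩
    mulK d (xᵏ i) (evalMonicFrom d x j (c ∷ cs))
      ∎
    where open ≡-Reasoning

  powK-reduce : ∀ i → xᵏ (i ℕ.+ length cs) ≡ (ℚ.- 1ℚ) · lowerTerms i cs
  powK-reduce i = ⊕≡0K⇒≡-1· (lowerTerms i cs) _ (begin
    lowerTerms i cs ⊕ xᵏ (i ℕ.+ length cs)     ≡⟨ sym (evalMonicFrom-split i cs) ⟩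
    evalMonicFrom d x i cs                     ≡⟨ cong (λ k → evalMonicFrom d x k cs) (sym (ℕP.+-identityʳ i)) ⟩
    evalMonicFrom d x (i ℕ.+ 0) cs             ≡⟨ evalMonicFrom-shift i 0 cs ⟩
    mulK d (xᵏ i) (evalMonic d cs x)           ≡⟨ cong (mulK d (xᵏ i)) root ⟩
    mulK d (xᵏ i) 0K                           ≡⟨ mulK-zeroʳ d (xᵏ i) ⟩
    0K                                         ∎)
    where open ≡-Reasoning

  IntK-lowerTerms : ∀ q i cs → (∀ {j} → j ℕ.< length cs → IntK (q · xᵏ (i ℕ.+ j))) → IntK (q · lowerTerms i cs)
  IntK-lowerTerms q i [] _ = subst IntK (sym (·-zeroʳ q)) ((+ 0 , refl) , (+ 0 , refl))
  IntK-lowerTerms q i (c ∷ cs) int = subst IntK (sym split) (IntK-⊕ (IntK-·ℤ c head) tail)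
    where
    split : q · lowerTerms i (c ∷ cs) ≡ (c ·ℤ (q · xᵏ i)) ⊕ (q · lowerTerms (suc i) cs)
    split = trans (·-distrib-⊕ q _ _) (cong (_⊕ _) (·-comm q (ℤ→ℚ c) (xᵏ i)))
    head : IntK (q · xᵏ i)
    head = subst (λ k → IntK (q · xᵏ k)) (ℕP.+-identityʳ i) (int (ℕ.s≤s ℕ.z≤n))
    tail : IntK (q · lowerTerms (suc i) cs)
    tail = IntK-lowerTerms q (suc i) cs (λ {j} j< → subst (λ k → IntK (q · xᵏ k)) (ℕP.+-suc i j) (int (ℕ.s≤s j<)))

  common-denominator-powK : ∃[ D ] (NonZero D × (∀ k → IntK (ℕ→ℚ D · xᵏ k)))
  common-denominator-powK with common-denominator xᵏ (length cs)
  ... | D , D≢0 , low = D , D≢0 , <-rec (λ k → IntK (ℕ→ℚ D · xᵏ k)) step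
    where
    step : ∀ k → (∀ {j} → j ℕ.< k → IntK (ℕ→ℚ D · xᵏ j)) → IntK (ℕ→ℚ D · xᵏ k)
    step k below with k ℕ.<? length cs
    ... | yes k<n = low k<n
    ... | no k≮n = subst (λ j → IntK (ℕ→ℚ D · xᵏ j)) i+n≡k
          (subst IntK (sym (trans (cong (ℕ→ℚ D ·_) (powK-reduce i)) (·-comm (ℕ→ℚ D) (ℚ.- 1ℚ) _)))
            (IntK-·ℤ -[1+ 0 ] (IntK-lowerTerms (ℕ→ℚ D) i cs
              (λ j<n → below (subst (i ℕ.+ _ ℕ.<_) i+n≡k (ℕP.+-monoʳ-< i j<n))))))
      where
      i = k ℕ.∸ length cs
      i+n≡k : i ℕ.+ length cs ≡ k
      i+n≡k = ℕP.m∸n+n≡m (ℕP.≮⇒≥ k≮n)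

-- Trace and norm of algebraic integers

tr : K → ℚ
tr (a , b) = a ℚ.+ a

nm : ℕ → K → ℚ
nm d (a , b) = a ℚ.* a ℚ.- ℕ→ℚ d ℚ.* (b ℚ.* b)

ℚ→K : ℚ → K
ℚ→K p = p , 0ℚ

module TraceNormOfRoot (d : ℕ) (x : K) (cs : List ℤ) (root : evalMonic d cs x ≡ 0K) where
  open PowersOfRoot d x cs root

  private
    D = proj₁ common-denominator-powK
    Dxᵏ = proj₂ (proj₂ common-denominator-powK)
    x̄ = conjK x
    x̄ᵏ = powK d x̄

  instance
    D≢0 : NonZero D
    D≢0 = proj₁ (proj₂ common-denominator-powK)
    D²≢0 : NonZero (D ℕ.* D)
    D²≢0 = ℕP.m*n≢0 D D

  Dx̄ᵏ : ∀ k → IntK (ℕ→ℚ D · x̄ᵏ k)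
  Dx̄ᵏ k = subst IntK (trans (conjK-· (ℕ→ℚ D) (xᵏ k)) (cong (ℕ→ℚ D ·_) (conjK-powK d x k))) (IntK-conjK (Dxᵏ k))

  D² = ℕ→ℚ (D ℕ.* D)

  -- The Bounded elements contain 1 and are closed under +, ·x and ·x̄, so they include all powers
  -- of Tr x = x + x̄ and N x = x x̄; this avoids expanding (x + x̄)ᵏ.
  Bounded : K → Set
  Bounded y = ∀ i j → IntK (D² · mulK d y (mulK d (xᵏ i) (x̄ᵏ j)))

  Bounded-1K : Bounded 1K
  Bounded-1K i j = subst IntK (sym (begin
    D² · mulK d 1K (mulK d (xᵏ i) (x̄ᵏ j))                   ≡⟨ cong (D² ·_) (mulK-identityˡ d _) ⟩
    D² · mulK d (xᵏ i) (x̄ᵏ j)                               ≡⟨ cong (_· mulK d (xᵏ i) (x̄ᵏ j)) (ℕ→ℚ-homo-* D D) ⟩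
    (ℕ→ℚ D ℚ.* ℕ→ℚ D) · mulK d (xᵏ i) (x̄ᵏ j)               ≡⟨ sym (·-assoc (ℕ→ℚ D) (ℕ→ℚ D) _) ⟩
    ℕ→ℚ D · (ℕ→ℚ D · mulK d (xᵏ i) (x̄ᵏ j))                 ≡⟨ cong (ℕ→ℚ D ·_) (sym (mulK-·ʳ d (ℕ→ℚ D) (xᵏ i) (x̄ᵏ j))) ⟩
    ℕ→ℚ D · mulK d (xᵏ i) (ℕ→ℚ D · x̄ᵏ j)                   ≡⟨ sym (mulK-·ˡ d (ℕ→ℚ D) (xᵏ i) _) ⟩
    mulK d (ℕ→ℚ D · xᵏ i) (ℕ→ℚ D · x̄ᵏ j)                   ∎))
    (IntK-mulK d (Dxᵏ i) (Dx̄ᵏ j))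
    where open ≡-Reasoning

  Bounded-*x : ∀ {y} → Bounded y → Bounded (mulK d y x)
  Bounded-*x {y} bounded i j = subst (λ z → IntK (D² · z)) (sym (begin
    mulK d (mulK d y x) (mulK d (xᵏ i) (x̄ᵏ j))   ≡⟨ mulK-assoc d y x _ ⟩
    mulK d y (mulK d x (mulK d (xᵏ i) (x̄ᵏ j)))   ≡⟨ cong (mulK d y) (sym (mulK-assoc d x (xᵏ i) (x̄ᵏ j))) ⟩
    mulK d y (mulK d (xᵏ (suc i)) (x̄ᵏ j))        ∎))
    (bounded (suc i) j)
    where open ≡-Reasoning

  Bounded-*x̄ : ∀ {y} → Bounded y → Bounded (mulK d y x̄)
  Bounded-*x̄ {y} bounded i j = subst (λ z → IntK (D² · z)) (sym (begin
    mulK d (mulK d y x̄) (mulK d (xᵏ i) (x̄ᵏ j))   ≡⟨ mulK-assoc d y x̄ _ ⟩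
    mulK d y (mulK d x̄ (mulK d (xᵏ i) (x̄ᵏ j)))   ≡⟨ cong (mulK d y) (sym (mulK-assoc d x̄ (xᵏ i) (x̄ᵏ j))) ⟩
    mulK d y (mulK d (mulK d x̄ (xᵏ i)) (x̄ᵏ j))   ≡⟨ cong (λ z → mulK d y (mulK d z (x̄ᵏ j))) (mulK-comm d x̄ (xᵏ i)) ⟩
    mulK d y (mulK d (mulK d (xᵏ i) x̄) (x̄ᵏ j))   ≡⟨ cong (mulK d y) (mulK-assoc d (xᵏ i) x̄ (x̄ᵏ j)) ⟩
    mulK d y (mulK d (xᵏ i) (x̄ᵏ (suc j)))        ∎))
    (bounded i (suc j))
    where open ≡-Reasoning

  Bounded-⊕ : ∀ {y z} → Bounded y → Bounded z → Bounded (y ⊕ z)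
  Bounded-⊕ {y} {z} bounded-y bounded-z i j =
    subst IntK (sym (trans (cong (D² ·_) (mulK-distribʳ-⊕ d _ y z)) (·-distrib-⊕ D² _ _)))
      (IntK-⊕ (bounded-y i j) (bounded-z i j))

  Bounded-tr^ : ∀ k → Bounded (ℚ→K (tr x ^ k))
  Bounded-tr^ zero = Bounded-1K
  Bounded-tr^ (suc k) = subst Bounded (cong₂ _,_ (re₁ (ℕ→ℚ d) p a b) (re₂ p a b))
    (Bounded-⊕ {mulK d (ℚ→K p) x} {mulK d (ℚ→K p) x̄} (Bounded-*x {ℚ→K p} (Bounded-tr^ k)) (Bounded-*x̄ {ℚ→K p} (Bounded-tr^ k)))
    where
    a = proj₁ x
    b = proj₂ x
    p = tr x ^ k
    re₁ : ∀ n p a b → p ℚ.* a ℚ.+ n ℚ.* (0ℚ ℚ.* b) ℚ.+ (p ℚ.* a ℚ.+ n ℚ.* (0ℚ ℚ.* ℚ.- b)) ≡ (a ℚ.+ a) ℚ.* p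
    re₁ = solve-∀ ℚ-ring
    re₂ : ∀ p a b → p ℚ.* b ℚ.+ 0ℚ ℚ.* a ℚ.+ (p ℚ.* ℚ.- b ℚ.+ 0ℚ ℚ.* a) ≡ 0ℚ
    re₂ = solve-∀ ℚ-ring

  Bounded-nm^ : ∀ k → Bounded (ℚ→K (nm d x ^ k))
  Bounded-nm^ zero = Bounded-1K
  Bounded-nm^ (suc k) = subst Bounded (cong₂ _,_ (re₁ (ℕ→ℚ d) p a b) (re₂ (ℕ→ℚ d) p a b))
    (Bounded-*x̄ {mulK d (ℚ→K p) x} (Bounded-*x {ℚ→K p} (Bounded-nm^ k)))
    where
    a = proj₁ x
    b = proj₂ x
    p = nm d x ^ k
    re₁ : ∀ n p a b → (p ℚ.* a ℚ.+ n ℚ.* (0ℚ ℚ.* b)) ℚ.* a ℚ.+ n ℚ.* ((p ℚ.* b ℚ.+ 0ℚ ℚ.* a) ℚ.* ℚ.- b)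
                    ≡ (a ℚ.* a ℚ.- n ℚ.* (b ℚ.* b)) ℚ.* p
    re₁ = solve-∀ ℚ-ring
    re₂ : ∀ n p a b → (p ℚ.* a ℚ.+ n ℚ.* (0ℚ ℚ.* b)) ℚ.* ℚ.- b ℚ.+ (p ℚ.* b ℚ.+ 0ℚ ℚ.* a) ℚ.* a ≡ 0ℚ
    re₂ = solve-∀ ℚ-ring

  Bounded-ℚ→K⇒Intℚ : ∀ p → Bounded (ℚ→K p) → Intℚ (D² ℚ.* p)
  Bounded-ℚ→K⇒Intℚ p bounded = subst Intℚ (re (ℕ→ℚ d) D² p) (proj₁ (bounded 0 0))
    where
    re : ∀ n D p → D ℚ.* (p ℚ.* (1ℚ ℚ.* 1ℚ ℚ.+ n ℚ.* (0ℚ ℚ.* ℚ.- 0ℚ)) ℚ.+ n ℚ.* (0ℚ ℚ.* (1ℚ ℚ.* ℚ.- 0ℚ ℚ.+ 0ℚ ℚ.* 1ℚ))) ≡ D ℚ.* p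
    re = solve-∀ ℚ-ring

  Intℚ-tr : Intℚ (tr x)
  Intℚ-tr = bounded-powers⇒Intℚ (D ℕ.* D) (tr x) (λ k → Bounded-ℚ→K⇒Intℚ _ (Bounded-tr^ k))

  Intℚ-nm : Intℚ (nm d x)
  Intℚ-nm = bounded-powers⇒Intℚ (D ℕ.* D) (nm d x) (λ k → Bounded-ℚ→K⇒Intℚ _ (Bounded-nm^ k))

InO⇒Intℚ-tr : ∀ d {x} → InO d x → Intℚ (tr x)
InO⇒Intℚ-tr d {x} (cs , root) = TraceNormOfRoot.Intℚ-tr d x cs root

InO⇒Intℚ-nm : ∀ d {x} → InO d x → Intℚ (nm d x)
InO⇒Intℚ-nm d {x} (cs , root) = TraceNormOfRoot.Intℚ-nm d x cs root

parity : ∀ i → ∃[ h ] (i ≡ + 2 ℤ.* h ⊎ i ≡ + 2 ℤ.* h ℤ.+ + 1)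
parity i with i ℤD.%ℕ 2 | ℤD.n%ℕd<d i 2 | ℤD.a≡a%ℕn+[a/ℕn]*n i 2
... | 0 | _ | i≡r+2q = i ℤD./ℕ 2 , inj₁ (trans i≡r+2q (re (i ℤD./ℕ 2)))
  where
  re : ∀ q → + 0 ℤ.+ q ℤ.* + 2 ≡ + 2 ℤ.* q
  re = ℤ-solve-∀
... | 1 | _ | i≡r+2q = i ℤD./ℕ 2 , inj₂ (trans i≡r+2q (re (i ℤD./ℕ 2)))
  where
  re : ∀ q → + 1 ℤ.+ q ℤ.* + 2 ≡ + 2 ℤ.* q ℤ.+ + 1
  re = ℤ-solve-∀
... | suc (suc _) | ℕ.s≤s (ℕ.s≤s ()) | _

1≢2* : ∀ j → + 1 ≢ + 2 ℤ.* j
1≢2* j 1≡2j with ∣1⇒≡1 (divides ℤ.∣ j ∣ (trans (cong ℤ.∣_∣ 1≡2j) (trans (ℤP.abs-* (+ 2) j) (ℕP.*-comm 2 ℤ.∣ j ∣))))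
... | ()

squares-congruent⇒even-difference : ∀ u w k → w ℤ.* w ≡ u ℤ.* u ℤ.+ + 4 ℤ.* k → ∃[ h ] u ℤ.- w ≡ + 2 ℤ.* h
squares-congruent⇒even-difference u w k w²≡u²+4k with parity (u ℤ.- w)
... | h , inj₁ even = h , even
... | h , inj₂ odd = ⊥-elim (1≢2* (+ 2 ℤ.* k ℤ.- m) (begin
  + 1                                                        ≡⟨ re₁ (u ℤ.* u) m ⟩
  (u ℤ.* u ℤ.+ + 2 ℤ.* m ℤ.+ + 1) ℤ.- (u ℤ.* u ℤ.+ + 2 ℤ.* m) ≡⟨ cong (ℤ._- (u ℤ.* u ℤ.+ + 2 ℤ.* m)) u²+2m+1≡u²+4k ⟩
  (u ℤ.* u ℤ.+ + 4 ℤ.* k) ℤ.- (u ℤ.* u ℤ.+ + 2 ℤ.* m)         ≡⟨ re₂ (u ℤ.* u) k m ⟩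
  + 2 ℤ.* (+ 2 ℤ.* k ℤ.- m)                                  ∎))
  where
  open ≡-Reasoning
  m = + 2 ℤ.* (h ℤ.* h) ℤ.+ + 2 ℤ.* h ℤ.- + 2 ℤ.* (u ℤ.* h) ℤ.- u
  odd-square : ∀ u h → (u ℤ.- (+ 2 ℤ.* h ℤ.+ + 1)) ℤ.* (u ℤ.- (+ 2 ℤ.* h ℤ.+ + 1))
                     ≡ u ℤ.* u ℤ.+ + 2 ℤ.* (+ 2 ℤ.* (h ℤ.* h) ℤ.+ + 2 ℤ.* h ℤ.- + 2 ℤ.* (u ℤ.* h) ℤ.- u) ℤ.+ + 1
  odd-square = ℤ-solve-∀
  u-[u-w]≡w : ∀ u w → u ℤ.- (u ℤ.- w) ≡ w
  u-[u-w]≡w = ℤ-solve-∀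
  u²+2m+1≡u²+4k : u ℤ.* u ℤ.+ + 2 ℤ.* m ℤ.+ + 1 ≡ u ℤ.* u ℤ.+ + 4 ℤ.* k
  u²+2m+1≡u²+4k = begin
    u ℤ.* u ℤ.+ + 2 ℤ.* m ℤ.+ + 1                          ≡⟨ sym (odd-square u h) ⟩
    (u ℤ.- (+ 2 ℤ.* h ℤ.+ + 1)) ℤ.* (u ℤ.- (+ 2 ℤ.* h ℤ.+ + 1)) ≡⟨ cong (λ v → (u ℤ.- v) ℤ.* (u ℤ.- v)) (sym odd) ⟩
    (u ℤ.- (u ℤ.- w)) ℤ.* (u ℤ.- (u ℤ.- w))                ≡⟨ cong (λ v → v ℤ.* v) (u-[u-w]≡w u w) ⟩
    w ℤ.* w                                                ≡⟨ w²≡u²+4k ⟩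
    u ℤ.* u ℤ.+ + 4 ℤ.* k                                  ∎
  re₁ : ∀ a m → + 1 ≡ (a ℤ.+ + 2 ℤ.* m ℤ.+ + 1) ℤ.- (a ℤ.+ + 2 ℤ.* m)
  re₁ = ℤ-solve-∀
  re₂ : ∀ a k m → (a ℤ.+ + 4 ℤ.* k) ℤ.- (a ℤ.+ + 2 ℤ.* m) ≡ + 2 ℤ.* (+ 2 ℤ.* k ℤ.- m)
  re₂ = ℤ-solve-∀

square-Intℚ⇒Intℚ : ∀ q → Intℚ (q ℚ.* q) → Intℚ q
square-Intℚ⇒Intℚ q q² = bounded-powers⇒Intℚ (ℚ.↧ₙ q) q bounded
  where
  M = ℕ→ℚ (ℚ.↧ₙ q)
  bounded : ∀ k → Intℚ (M ℚ.* q ^ k)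
  bounded zero = + ℚ.↧ₙ q , sym (ℚP.*-identityʳ M)
  bounded (suc zero) = ℚ.↥ q , trans (sym (↧ₙ*≡↥ q)) (cong (M ℚ.*_) (sym (ℚP.*-identityʳ q)))
  bounded (suc (suc k)) = subst Intℚ (re M q (q ^ k)) (Intℚ-* q² (bounded k))
    where
    re : ∀ M q p → (q ℚ.* q) ℚ.* (M ℚ.* p) ≡ M ℚ.* (q ℚ.* (q ℚ.* p))
    re = solve-∀ ℚ-ring

Intℚ-half-difference : ∀ {p r k} → Intℚ p → Intℚ r → Intℚ k → r ℚ.* r ≡ p ℚ.* p ℚ.+ (+ 4 / 1) ℚ.* k →
                       Intℚ (ℚ.½ ℚ.* (p ℚ.- r))
Intℚ-half-difference (u , refl) (ω , refl) (k , refl) ω²≡u²+4k = h , (begin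
  ℤ→ℚ h                             ≡⟨ sym (half (ℤ→ℚ h)) ⟩
  ℚ.½ ℚ.* (ℤ→ℚ (+ 2) ℚ.* ℤ→ℚ h)     ≡⟨ cong (ℚ.½ ℚ.*_) (sym (ℤ→ℚ-homo-* (+ 2) h)) ⟩
  ℚ.½ ℚ.* ℤ→ℚ (+ 2 ℤ.* h)           ≡⟨ cong (λ i → ℚ.½ ℚ.* ℤ→ℚ i) (sym u-ω≡2h) ⟩
  ℚ.½ ℚ.* ℤ→ℚ (u ℤ.- ω)             ≡⟨ cong (ℚ.½ ℚ.*_) (trans (ℤ→ℚ-homo-+ u (- ω)) (cong (ℤ→ℚ u ℚ.+_) (ℤ→ℚ-homo‿- ω))) ⟩
  ℚ.½ ℚ.* (ℤ→ℚ u ℚ.- ℤ→ℚ ω)         ∎)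
  where
  open ≡-Reasoning
  half : ∀ p → ℚ.½ ℚ.* ((+ 2 / 1) ℚ.* p) ≡ p
  half = solve-∀ ℚ-ring
  ω²≡u²+4k-ℤ : ω ℤ.* ω ≡ u ℤ.* u ℤ.+ + 4 ℤ.* k
  ω²≡u²+4k-ℤ = ℤ→ℚ-injective (begin
    ℤ→ℚ (ω ℤ.* ω)                           ≡⟨ ℤ→ℚ-homo-* ω ω ⟩
    ℤ→ℚ ω ℚ.* ℤ→ℚ ω                         ≡⟨ ω²≡u²+4k ⟩
    ℤ→ℚ u ℚ.* ℤ→ℚ u ℚ.+ ℤ→ℚ (+ 4) ℚ.* ℤ→ℚ k ≡⟨ cong₂ ℚ._+_ (ℤ→ℚ-homo-* u u) (ℤ→ℚ-homo-* (+ 4) k) ⟨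
    ℤ→ℚ (u ℤ.* u) ℚ.+ ℤ→ℚ (+ 4 ℤ.* k)       ≡⟨ ℤ→ℚ-homo-+ (u ℤ.* u) (+ 4 ℤ.* k) ⟨
    ℤ→ℚ (u ℤ.* u ℤ.+ + 4 ℤ.* k)             ∎)
  h = proj₁ (squares-congruent⇒even-difference u ω k ω²≡u²+4k-ℤ)
  u-ω≡2h = proj₂ (squares-congruent⇒even-difference u ω k ω²≡u²+4k-ℤ)

-- With w = 4d b₁b₂, w² = disc x · disc y is an integer, hence so is w, and w² ≡ (Tr x Tr y)² mod 4;
-- so Tr(x ȳ) = (Tr x Tr y − w) / 2 is an integer.
Intℚ-tr-mulK-conjK : ∀ d x y → Intℚ (tr x) → Intℚ (nm d x) → Intℚ (tr y) → Intℚ (nm d y) →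
                     Intℚ (tr (mulK d x (conjK y)))
Intℚ-tr-mulK-conjK d x@(a₁ , b₁) y@(a₂ , b₂) T₁ N₁ T₂ N₂ =
  subst Intℚ (re-tr (ℕ→ℚ d) a₁ b₁ a₂ b₂) (Intℚ-half-difference (Intℚ-* T₁ T₂) W k (re-w² (ℕ→ℚ d) a₁ b₁ a₂ b₂))
  where
  w = ℕ→ℚ d ℚ.* ((b₁ ℚ.+ b₁) ℚ.* (b₂ ℚ.+ b₂))
  re-disc : ∀ n a₁ b₁ a₂ b₂ →
          (n ℚ.* ((b₁ ℚ.+ b₁) ℚ.* (b₂ ℚ.+ b₂))) ℚ.* (n ℚ.* ((b₁ ℚ.+ b₁) ℚ.* (b₂ ℚ.+ b₂)))
          ≡ ((a₁ ℚ.+ a₁) ℚ.* (a₁ ℚ.+ a₁) ℚ.- (+ 4 / 1) ℚ.* (a₁ ℚ.* a₁ ℚ.- n ℚ.* (b₁ ℚ.* b₁)))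
            ℚ.* ((a₂ ℚ.+ a₂) ℚ.* (a₂ ℚ.+ a₂) ℚ.- (+ 4 / 1) ℚ.* (a₂ ℚ.* a₂ ℚ.- n ℚ.* (b₂ ℚ.* b₂)))
  re-disc = solve-∀ ℚ-ring
  re-w² : ∀ n a₁ b₁ a₂ b₂ →
          (n ℚ.* ((b₁ ℚ.+ b₁) ℚ.* (b₂ ℚ.+ b₂))) ℚ.* (n ℚ.* ((b₁ ℚ.+ b₁) ℚ.* (b₂ ℚ.+ b₂)))
          ≡ ((a₁ ℚ.+ a₁) ℚ.* (a₂ ℚ.+ a₂)) ℚ.* ((a₁ ℚ.+ a₁) ℚ.* (a₂ ℚ.+ a₂))
            ℚ.+ (+ 4 / 1) ℚ.* ((+ 4 / 1) ℚ.* ((a₁ ℚ.* a₁ ℚ.- n ℚ.* (b₁ ℚ.* b₁)) ℚ.* (a₂ ℚ.* a₂ ℚ.- n ℚ.* (b₂ ℚ.* b₂)))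
                 ℚ.- (a₁ ℚ.* a₁ ℚ.- n ℚ.* (b₁ ℚ.* b₁)) ℚ.* ((a₂ ℚ.+ a₂) ℚ.* (a₂ ℚ.+ a₂))
                 ℚ.- (a₂ ℚ.* a₂ ℚ.- n ℚ.* (b₂ ℚ.* b₂)) ℚ.* ((a₁ ℚ.+ a₁) ℚ.* (a₁ ℚ.+ a₁)))
  re-w² = solve-∀ ℚ-ring
  re-tr : ∀ n a₁ b₁ a₂ b₂ →
          ℚ.½ ℚ.* ((a₁ ℚ.+ a₁) ℚ.* (a₂ ℚ.+ a₂) ℚ.- n ℚ.* ((b₁ ℚ.+ b₁) ℚ.* (b₂ ℚ.+ b₂)))
          ≡ (a₁ ℚ.* a₂ ℚ.+ n ℚ.* (b₁ ℚ.* ℚ.- b₂)) ℚ.+ (a₁ ℚ.* a₂ ℚ.+ n ℚ.* (b₁ ℚ.* ℚ.- b₂))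
  re-tr = solve-∀ ℚ-ring
  disc : ∀ {T N} → Intℚ T → Intℚ N → Intℚ (T ℚ.* T ℚ.- (+ 4 / 1) ℚ.* N)
  disc T N = Intℚ-+ (Intℚ-* T T) (Intℚ-neg (Intℚ-* (+ 4 , refl) N))
  W : Intℚ w
  W = square-Intℚ⇒Intℚ w (subst Intℚ (sym (re-disc (ℕ→ℚ d) a₁ b₁ a₂ b₂)) (Intℚ-* (disc T₁ N₁) (disc T₂ N₂)))
  k = Intℚ-+ (Intℚ-+ (Intℚ-* (+ 4 , refl) (Intℚ-* N₁ N₂)) (Intℚ-neg (Intℚ-* N₁ (Intℚ-* T₂ T₂))))
             (Intℚ-neg (Intℚ-* N₂ (Intℚ-* T₁ T₁)))

-- x is a root of X² − Tr(x) X + N(x).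
tr-nm⇒InO : ∀ d x → Intℚ (tr x) → Intℚ (nm d x) → InO d x
tr-nm⇒InO d x@(a , b) (t , t≡tr) (n , n≡nm) = (n ∷ - t ∷ []) , cong₂ _,_
  (trans (cong₂ (λ p r → p ℚ.* 1ℚ ℚ.+ (r ℚ.* _ ℚ.+ _)) n≡nm -t≡-tr) (re₁ (ℕ→ℚ d) a b))
  (trans (cong₂ (λ p r → p ℚ.* 0ℚ ℚ.+ (r ℚ.* _ ℚ.+ _)) n≡nm -t≡-tr) (re₂ (ℕ→ℚ d) a b))
  where
  -t≡-tr : ℤ→ℚ (- t) ≡ ℚ.- tr x
  -t≡-tr = trans (ℤ→ℚ-homo‿- t) (cong ℚ.-_ t≡tr)
  re₁ : ∀ n a b → (a ℚ.* a ℚ.- n ℚ.* (b ℚ.* b)) ℚ.* 1ℚ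
                  ℚ.+ ((ℚ.- (a ℚ.+ a)) ℚ.* (a ℚ.* 1ℚ ℚ.+ n ℚ.* (b ℚ.* 0ℚ))
                  ℚ.+ (a ℚ.* (a ℚ.* 1ℚ ℚ.+ n ℚ.* (b ℚ.* 0ℚ)) ℚ.+ n ℚ.* (b ℚ.* (a ℚ.* 0ℚ ℚ.+ b ℚ.* 1ℚ)))) ≡ 0ℚ
  re₁ = solve-∀ ℚ-ring
  re₂ : ∀ n a b → (a ℚ.* a ℚ.- n ℚ.* (b ℚ.* b)) ℚ.* 0ℚ
                  ℚ.+ ((ℚ.- (a ℚ.+ a)) ℚ.* (a ℚ.* 0ℚ ℚ.+ b ℚ.* 1ℚ)
                  ℚ.+ (a ℚ.* (a ℚ.* 0ℚ ℚ.+ b ℚ.* 1ℚ) ℚ.+ b ℚ.* (a ℚ.* 1ℚ ℚ.+ n ℚ.* (b ℚ.* 0ℚ)))) ≡ 0ℚ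
  re₂ = solve-∀ ℚ-ring

tr-lincomb : ∀ r s x y → tr ((r · x) ⊕ (s · y)) ≡ r ℚ.* tr x ℚ.+ s ℚ.* tr y
tr-lincomb r s (a₁ , _) (a₂ , _) = re r s a₁ a₂
  where
  re : ∀ r s a₁ a₂ → (r ℚ.* a₁ ℚ.+ s ℚ.* a₂) ℚ.+ (r ℚ.* a₁ ℚ.+ s ℚ.* a₂) ≡ r ℚ.* (a₁ ℚ.+ a₁) ℚ.+ s ℚ.* (a₂ ℚ.+ a₂)
  re = solve-∀ ℚ-ring

nm-lincomb : ∀ d r s x y → nm d ((r · x) ⊕ (s · y))
                           ≡ r ℚ.* r ℚ.* nm d x ℚ.+ s ℚ.* s ℚ.* nm d y ℚ.+ r ℚ.* s ℚ.* tr (mulK d x (conjK y))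
nm-lincomb d r s (a₁ , b₁) (a₂ , b₂) = re (ℕ→ℚ d) r s a₁ b₁ a₂ b₂
  where
  re : ∀ n r s a₁ b₁ a₂ b₂ →
       (r ℚ.* a₁ ℚ.+ s ℚ.* a₂) ℚ.* (r ℚ.* a₁ ℚ.+ s ℚ.* a₂) ℚ.- n ℚ.* ((r ℚ.* b₁ ℚ.+ s ℚ.* b₂) ℚ.* (r ℚ.* b₁ ℚ.+ s ℚ.* b₂))
       ≡ r ℚ.* r ℚ.* (a₁ ℚ.* a₁ ℚ.- n ℚ.* (b₁ ℚ.* b₁)) ℚ.+ s ℚ.* s ℚ.* (a₂ ℚ.* a₂ ℚ.- n ℚ.* (b₂ ℚ.* b₂))
         ℚ.+ r ℚ.* s ℚ.* ((a₁ ℚ.* a₂ ℚ.+ n ℚ.* (b₁ ℚ.* ℚ.- b₂)) ℚ.+ (a₁ ℚ.* a₂ ℚ.+ n ℚ.* (b₁ ℚ.* ℚ.- b₂)))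
  re = solve-∀ ℚ-ring

InO-lincomb : ∀ d {x y} → InO d x → InO d y → ∀ i j → InO d ((i ·ℤ x) ⊕ (j ·ℤ y))
InO-lincomb d {x} {y} x∈O y∈O i j = tr-nm⇒InO d ((i ·ℤ x) ⊕ (j ·ℤ y))
  (subst Intℚ (sym (tr-lincomb (ℤ→ℚ i) (ℤ→ℚ j) x y)) (Intℚ-+ (Intℚ-* iℤ Tx) (Intℚ-* jℤ Ty)))
  (subst Intℚ (sym (nm-lincomb d (ℤ→ℚ i) (ℤ→ℚ j) x y))
    (Intℚ-+ (Intℚ-+ (Intℚ-* (Intℚ-* iℤ iℤ) Nx) (Intℚ-* (Intℚ-* jℤ jℤ) Ny))
            (Intℚ-* (Intℚ-* iℤ jℤ) (Intℚ-tr-mulK-conjK d x y Tx Nx Ty Ny))))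
  where
  iℤ : Intℚ (ℤ→ℚ i)
  iℤ = i , refl
  jℤ : Intℚ (ℤ→ℚ j)
  jℤ = j , refl
  Tx = InO⇒Intℚ-tr d x∈O
  Nx = InO⇒Intℚ-nm d x∈O
  Ty = InO⇒Intℚ-tr d y∈O
  Ny = InO⇒Intℚ-nm d y∈O

-- Coordinates and the cone

ℤ-Independent : K → K → Set
ℤ-Independent β₁ β₂ = (y₁ y₂ : ℤ) → (y₁ ·ℤ β₁) ⊕ (y₂ ·ℤ β₂) ≡ 0K → (y₁ ≡ + 0) × (y₂ ≡ + 0)

[1+k]↥q≡0⇒q≡0 : ∀ k q → + suc k ℤ.* ℚ.↥ q ≡ + 0 → q ≡ 0ℚ
[1+k]↥q≡0⇒q≡0 k q k↥q≡0 with ℤP.i*j≡0⇒i≡0∨j≡0 (+ suc k) k↥q≡0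
... | inj₁ ()
... | inj₂ ↥q≡0 = ℚP.↥p≡0⇒p≡0 q ↥q≡0

ℤ-independent⇒ℚ-independent : ∀ {β₁ β₂} → ℤ-Independent β₁ β₂ →
                              ∀ r s → (r · β₁) ⊕ (s · β₂) ≡ 0K → (r ≡ 0ℚ) × (s ≡ 0ℚ)
ℤ-independent⇒ℚ-independent {β₁} {β₂} indep r s rβ₁+sβ₂≡0 =
  [1+k]↥q≡0⇒q≡0 (ℚ.denominator-1 s) r (proj₁ i,j≡0) , [1+k]↥q≡0⇒q≡0 (ℚ.denominator-1 r) s (proj₂ i,j≡0)
  where
  Dr = ℕ→ℚ (ℚ.↧ₙ r)
  Ds = ℕ→ℚ (ℚ.↧ₙ s)
  i = + ℚ.↧ₙ s ℤ.* ℚ.↥ r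
  j = + ℚ.↧ₙ r ℤ.* ℚ.↥ s
  scale : ∀ Dr Ds r s p q → (Dr ℚ.* Ds) ℚ.* (r ℚ.* p ℚ.+ s ℚ.* q) ≡ (Ds ℚ.* (Dr ℚ.* r)) ℚ.* p ℚ.+ (Dr ℚ.* (Ds ℚ.* s)) ℚ.* q
  scale = solve-∀ ℚ-ring
  ℤ→ℚ-i : ℤ→ℚ i ≡ Ds ℚ.* (Dr ℚ.* r)
  ℤ→ℚ-i = trans (ℤ→ℚ-homo-* (+ ℚ.↧ₙ s) (ℚ.↥ r)) (cong (Ds ℚ.*_) (sym (↧ₙ*≡↥ r)))
  ℤ→ℚ-j : ℤ→ℚ j ≡ Dr ℚ.* (Ds ℚ.* s)
  ℤ→ℚ-j = trans (ℤ→ℚ-homo-* (+ ℚ.↧ₙ r) (ℚ.↥ s)) (cong (Dr ℚ.*_) (sym (↧ₙ*≡↥ s)))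
  iβ₁+jβ₂≡0 : (i ·ℤ β₁) ⊕ (j ·ℤ β₂) ≡ 0K
  iβ₁+jβ₂≡0 = begin
    (i ·ℤ β₁) ⊕ (j ·ℤ β₂)                                        ≡⟨ cong₂ (λ p q → (p · β₁) ⊕ (q · β₂)) ℤ→ℚ-i ℤ→ℚ-j ⟩
    ((Ds ℚ.* (Dr ℚ.* r)) · β₁) ⊕ ((Dr ℚ.* (Ds ℚ.* s)) · β₂)
        ≡⟨ cong₂ _,_ (sym (scale Dr Ds r s (proj₁ β₁) (proj₁ β₂))) (sym (scale Dr Ds r s (proj₂ β₁) (proj₂ β₂))) ⟩
    (Dr ℚ.* Ds) · ((r · β₁) ⊕ (s · β₂))                          ≡⟨ cong ((Dr ℚ.* Ds) ·_) rβ₁+sβ₂≡0 ⟩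
    (Dr ℚ.* Ds) · 0K                                             ≡⟨ ·-zeroʳ (Dr ℚ.* Ds) ⟩
    0K                                                           ∎
    where open ≡-Reasoning
  i,j≡0 = indep i j iβ₁+jβ₂≡0

lincomb-injective : ∀ {β₁ β₂} → ℤ-Independent β₁ β₂ →
                    ∀ {r₁ r₂ s₁ s₂} → (r₁ · β₁) ⊕ (r₂ · β₂) ≡ (s₁ · β₁) ⊕ (s₂ · β₂) → (r₁ ≡ s₁) × (r₂ ≡ s₂)
lincomb-injective {β₁} {β₂} indep {r₁} {r₂} {s₁} {s₂} r≡s =
  x∙y⁻¹≈ε⇒x≈y r₁ s₁ (proj₁ r-s≡0) , x∙y⁻¹≈ε⇒x≈y r₂ s₂ (proj₂ r-s≡0)
  where
  difference : ∀ p q → r₁ ℚ.* p ℚ.+ r₂ ℚ.* q ≡ s₁ ℚ.* p ℚ.+ s₂ ℚ.* q → (r₁ ℚ.- s₁) ℚ.* p ℚ.+ (r₂ ℚ.- s₂) ℚ.* q ≡ 0ℚ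
  difference p q eq = trans (re r₁ r₂ s₁ s₂ p q)
    (trans (cong (ℚ._- (s₁ ℚ.* p ℚ.+ s₂ ℚ.* q)) eq) (ℚP.+-inverseʳ (s₁ ℚ.* p ℚ.+ s₂ ℚ.* q)))
    where
    re : ∀ r₁ r₂ s₁ s₂ p q → (r₁ ℚ.- s₁) ℚ.* p ℚ.+ (r₂ ℚ.- s₂) ℚ.* q ≡ (r₁ ℚ.* p ℚ.+ r₂ ℚ.* q) ℚ.- (s₁ ℚ.* p ℚ.+ s₂ ℚ.* q)
    re = solve-∀ ℚ-ring
  r-s≡0 = ℤ-independent⇒ℚ-independent indep (r₁ ℚ.- s₁) (r₂ ℚ.- s₂)
    (cong₂ _,_ (difference (proj₁ β₁) (proj₁ β₂) (cong proj₁ r≡s)) (difference (proj₂ β₁) (proj₂ β₂) (cong proj₂ r≡s)))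

ℤ→ℚ-nonNeg : ∀ {i} → + 0 ℤ.≤ i → 0ℚ ℚ.≤ ℤ→ℚ i
ℤ→ℚ-nonNeg {+ n} _ = ℚP.nonNegative⁻¹ _ {{ℚP.normalize-nonNeg n 1}}

ℤ→ℚ-nonNeg⁻¹ : ∀ {i} → 0ℚ ℚ.≤ ℤ→ℚ i → + 0 ℤ.≤ i
ℤ→ℚ-nonNeg⁻¹ {+ n} _ = ℤ.+≤+ ℕ.z≤n
ℤ→ℚ-nonNeg⁻¹ { -[1+ n ]} 0≤i = ⊥-elim (ℚP.nonNeg≢neg (ℤ→ℚ -[1+ n ]) (ℤ→ℚ -[1+ n ]) {{ℚ.nonNegative 0≤i}}
  {{ℚP.neg-pos {ℚ.normalize (suc n) 1} (ℚP.normalize-pos (suc n) 1)}} refl)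

/-nonNeg : ∀ m n .{{_ : NonZero n}} → 0ℚ ℚ.≤ + m / n
/-nonNeg m n = ℚP.nonNegative⁻¹ _ {{ℚP.normalize-nonNeg m n}}

nonNeg-+ : ∀ {p q} → 0ℚ ℚ.≤ p → 0ℚ ℚ.≤ q → 0ℚ ℚ.≤ p ℚ.+ q
nonNeg-+ 0≤p 0≤q = ℚP.+-mono-≤ 0≤p 0≤q

nonNeg-* : ∀ {p q} → 0ℚ ℚ.≤ p → 0ℚ ℚ.≤ q → 0ℚ ℚ.≤ p ℚ.* q
nonNeg-* {p} {q} 0≤p 0≤q = ℚP.nonNegative⁻¹ _ {{ℚP.nonNeg*nonNeg⇒nonNeg p {{ℚ.nonNegative 0≤p}} q {{ℚ.nonNegative 0≤q}}}}

/-*-cancel : ∀ m n .{{_ : NonZero n}} → (+ m / n) ℚ.* ℕ→ℚ n ≡ ℕ→ℚ m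
/-*-cancel m (suc k) = ≡ℤ→ℚ (+ m) (ℚᵘP.≃-trans (ℚP.toℚᵘ-homo-* (+ m / suc k) (ℕ→ℚ (suc k)))
  (ℚᵘP.≃-trans (ℚᵘP.*-cong (ℚP.toℚᵘ-fromℚᵘ (ℚᵘ.mkℚᵘ (+ m) k)) (toℚᵘ-ℤ→ℚ (+ suc k))) (ℚᵘ.*≡* (cross k m))))
  where
  commute : ∀ a s → (a ℤ.* s) ℤ.* + 1 ≡ a ℤ.* s
  commute = ℤ-solve-∀
  cross : ∀ k m → (+ m ℤ.* + suc k) ℤ.* + 1 ≡ + m ℤ.* + suc (k ℕ.* 1)
  cross k m rewrite ℕP.*-identityʳ k = commute (+ m) (+ suc k)

cone-expansion : ∀ X₁ X₂ X₃ c₁ c₂ β₁ β₂ → (X₁ · β₁) ⊕ ((X₂ · β₂) ⊕ (X₃ · ((c₂ · β₂) ⊕ (c₁ · β₁))))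
                                          ≡ ((X₁ ℚ.+ c₁ ℚ.* X₃) · β₁) ⊕ ((X₂ ℚ.+ c₂ ℚ.* X₃) · β₂)
cone-expansion X₁ X₂ X₃ c₁ c₂ (p₁ , q₁) (p₂ , q₂) = cong₂ _,_ (re X₁ X₂ X₃ c₁ c₂ p₁ p₂) (re X₁ X₂ X₃ c₁ c₂ q₁ q₂)
  where
  re : ∀ X₁ X₂ X₃ c₁ c₂ p₁ p₂ → X₁ ℚ.* p₁ ℚ.+ (X₂ ℚ.* p₂ ℚ.+ X₃ ℚ.* (c₂ ℚ.* p₂ ℚ.+ c₁ ℚ.* p₁))
                                 ≡ (X₁ ℚ.+ c₁ ℚ.* X₃) ℚ.* p₁ ℚ.+ (X₂ ℚ.+ c₂ ℚ.* X₃) ℚ.* p₂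
  re = solve-∀ ℚ-ring

module Cone (β₁ β₂ : K) (a₁ a₂ : ℕ) .{{_ : NonZero a₁}} where

  α : K
  α = ((+ a₂) ·ℤ β₂) ⊕ ((- (+ a₁)) ·ℤ β₁)

  ρ : ℚ
  ρ = + a₂ / a₁

  private
    A₁ = ℕ→ℚ a₁
    A₂ = ℕ→ℚ a₂
    ι = + 1 / a₁

    ρ≡A₂ι : ρ ≡ A₂ ℚ.* ι
    ρ≡A₂ι = begin
      ρ                    ≡⟨ sym (ℚP.*-identityʳ ρ) ⟩
      ρ ℚ.* 1ℚ             ≡⟨ cong (ρ ℚ.*_) (sym (/-*-cancel 1 a₁)) ⟩
      ρ ℚ.* (ι ℚ.* A₁)     ≡⟨ re ρ ι A₁ ⟩
      (ρ ℚ.* A₁) ℚ.* ι     ≡⟨ cong (ℚ._* ι) (/-*-cancel a₂ a₁) ⟩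
      A₂ ℚ.* ι             ∎
      where
      open ≡-Reasoning
      re : ∀ ρ ι A₁ → ρ ℚ.* (ι ℚ.* A₁) ≡ (ρ ℚ.* A₁) ℚ.* ι
      re = solve-∀ ℚ-ring

  InCone3⇒coordinates : ℤ-Independent β₁ β₂ → ∀ {Y₁ Y₂} → InCone3 β₁ β₂ α ((Y₁ · β₁) ⊕ (Y₂ · β₂)) →
                        (0ℚ ℚ.≤ Y₂) × (ℚ.- (ρ ℚ.* Y₁) ℚ.≤ Y₂)
  InCone3⇒coordinates indep {Y₁} {Y₂} (X₁ , X₂ , X₃ , 0≤X₁ , 0≤X₂ , 0≤X₃ , Y≡X) =
    subst (0ℚ ℚ.≤_) Y₂≡ (nonNeg-+ 0≤X₂ (nonNeg-* (/-nonNeg a₂ 1) 0≤X₃)) ,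
    subst₂ ℚ._≤_ (ℚP.+-identityʳ (ℚ.- (ρ ℚ.* Y₁))) Y₂≡-ρY₁+[X₂+ρX₁] (ℚP.+-monoʳ-≤ (ℚ.- (ρ ℚ.* Y₁)) 0≤X₂+ρX₁)
    where
    0≤X₂+ρX₁ : 0ℚ ℚ.≤ X₂ ℚ.+ ρ ℚ.* X₁
    0≤X₂+ρX₁ = nonNeg-+ 0≤X₂ (nonNeg-* (/-nonNeg a₂ a₁) 0≤X₁)
    coordinates = lincomb-injective indep (trans (sym (cone-expansion X₁ X₂ X₃ (ℤ→ℚ (- (+ a₁))) A₂ β₁ β₂)) (sym Y≡X))
    Y₁≡ : X₁ ℚ.+ ℤ→ℚ (- (+ a₁)) ℚ.* X₃ ≡ Y₁
    Y₁≡ = proj₁ coordinates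
    Y₂≡ : X₂ ℚ.+ A₂ ℚ.* X₃ ≡ Y₂
    Y₂≡ = proj₂ coordinates
    Y₂≡-ρY₁+[X₂+ρX₁] : ℚ.- (ρ ℚ.* Y₁) ℚ.+ (X₂ ℚ.+ ρ ℚ.* X₁) ≡ Y₂
    Y₂≡-ρY₁+[X₂+ρX₁] = begin
      ℚ.- (ρ ℚ.* Y₁) ℚ.+ (X₂ ℚ.+ ρ ℚ.* X₁)                     ≡⟨ cong (λ y → ℚ.- (ρ ℚ.* y) ℚ.+ (X₂ ℚ.+ ρ ℚ.* X₁)) (sym Y₁≡) ⟩
      ℚ.- (ρ ℚ.* (X₁ ℚ.+ ℤ→ℚ (- (+ a₁)) ℚ.* X₃)) ℚ.+ (X₂ ℚ.+ ρ ℚ.* X₁)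
          ≡⟨ cong (λ c → ℚ.- (ρ ℚ.* (X₁ ℚ.+ c ℚ.* X₃)) ℚ.+ (X₂ ℚ.+ ρ ℚ.* X₁)) (ℤ→ℚ-homo‿- (+ a₁)) ⟩
      ℚ.- (ρ ℚ.* (X₁ ℚ.+ ℚ.- A₁ ℚ.* X₃)) ℚ.+ (X₂ ℚ.+ ρ ℚ.* X₁)  ≡⟨ re ρ A₁ X₁ X₂ X₃ ⟩
      X₂ ℚ.+ (ρ ℚ.* A₁) ℚ.* X₃                                 ≡⟨ cong (λ a → X₂ ℚ.+ a ℚ.* X₃) (/-*-cancel a₂ a₁) ⟩
      X₂ ℚ.+ A₂ ℚ.* X₃                                         ≡⟨ Y₂≡ ⟩
      Y₂                                                       ∎
      where
      open ≡-Reasoning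
      re : ∀ ρ A₁ X₁ X₂ X₃ → ℚ.- (ρ ℚ.* (X₁ ℚ.+ ℚ.- A₁ ℚ.* X₃)) ℚ.+ (X₂ ℚ.+ ρ ℚ.* X₁) ≡ X₂ ℚ.+ (ρ ℚ.* A₁) ℚ.* X₃
      re = solve-∀ ℚ-ring

  coordinates⇒InCone3 : ∀ {Y₁ Y₂} → 0ℚ ℚ.≤ Y₂ → ℚ.- (ρ ℚ.* Y₁) ℚ.≤ Y₂ → InCone3 β₁ β₂ α ((Y₁ · β₁) ⊕ (Y₂ · β₂))
  coordinates⇒InCone3 {Y₁} {Y₂} 0≤Y₂ -ρY₁≤Y₂ with ℚP.≤-total 0ℚ Y₁
  ... | inj₁ 0≤Y₁ = Y₁ , Y₂ , 0ℚ , 0≤Y₁ , 0≤Y₂ , ℚP.≤-refl ,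
    trans (cong₂ (λ y₁ y₂ → (y₁ · β₁) ⊕ (y₂ · β₂)) (re Y₁ (ℤ→ℚ (- (+ a₁)))) (re Y₂ A₂))
          (sym (cone-expansion Y₁ Y₂ 0ℚ (ℤ→ℚ (- (+ a₁))) A₂ β₁ β₂))
    where
    re : ∀ y c → y ≡ y ℚ.+ c ℚ.* 0ℚ
    re = solve-∀ ℚ-ring
  ... | inj₂ Y₁≤0 = 0ℚ , Y₂ ℚ.+ ρ ℚ.* Y₁ , ℚ.- Y₁ ℚ.* ι , ℚP.≤-refl , 0≤Y₂+ρY₁ , nonNeg-* 0≤-Y₁ (/-nonNeg 1 a₁) ,
    trans (cong₂ (λ y₁ y₂ → (y₁ · β₁) ⊕ (y₂ · β₂)) (sym first) (sym second))
          (sym (cone-expansion 0ℚ (Y₂ ℚ.+ ρ ℚ.* Y₁) (ℚ.- Y₁ ℚ.* ι) (ℤ→ℚ (- (+ a₁))) A₂ β₁ β₂))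
    where
    open ≡-Reasoning
    0≤-Y₁ : 0ℚ ℚ.≤ ℚ.- Y₁
    0≤-Y₁ = ℚP.neg-antimono-≤ Y₁≤0
    0≤Y₂+ρY₁ : 0ℚ ℚ.≤ Y₂ ℚ.+ ρ ℚ.* Y₁
    0≤Y₂+ρY₁ = subst (ℚ._≤ Y₂ ℚ.+ ρ ℚ.* Y₁) (ℚP.+-inverseˡ (ρ ℚ.* Y₁)) (ℚP.+-monoˡ-≤ (ρ ℚ.* Y₁) -ρY₁≤Y₂)
    first : 0ℚ ℚ.+ ℤ→ℚ (- (+ a₁)) ℚ.* (ℚ.- Y₁ ℚ.* ι) ≡ Y₁
    first = begin
      0ℚ ℚ.+ ℤ→ℚ (- (+ a₁)) ℚ.* (ℚ.- Y₁ ℚ.* ι) ≡⟨ cong (λ c → 0ℚ ℚ.+ c ℚ.* (ℚ.- Y₁ ℚ.* ι)) (ℤ→ℚ-homo‿- (+ a₁)) ⟩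
      0ℚ ℚ.+ ℚ.- A₁ ℚ.* (ℚ.- Y₁ ℚ.* ι)         ≡⟨ re A₁ Y₁ ι ⟩
      Y₁ ℚ.* (ι ℚ.* A₁)                        ≡⟨ cong (Y₁ ℚ.*_) (/-*-cancel 1 a₁) ⟩
      Y₁ ℚ.* 1ℚ                                ≡⟨ ℚP.*-identityʳ Y₁ ⟩
      Y₁                                       ∎
      where
      re : ∀ A₁ Y₁ ι → 0ℚ ℚ.+ ℚ.- A₁ ℚ.* (ℚ.- Y₁ ℚ.* ι) ≡ Y₁ ℚ.* (ι ℚ.* A₁)
      re = solve-∀ ℚ-ring
    second : Y₂ ℚ.+ ρ ℚ.* Y₁ ℚ.+ A₂ ℚ.* (ℚ.- Y₁ ℚ.* ι) ≡ Y₂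
    second = begin
      Y₂ ℚ.+ ρ ℚ.* Y₁ ℚ.+ A₂ ℚ.* (ℚ.- Y₁ ℚ.* ι)       ≡⟨ cong (λ r → Y₂ ℚ.+ r ℚ.* Y₁ ℚ.+ A₂ ℚ.* (ℚ.- Y₁ ℚ.* ι)) ρ≡A₂ι ⟩
      Y₂ ℚ.+ (A₂ ℚ.* ι) ℚ.* Y₁ ℚ.+ A₂ ℚ.* (ℚ.- Y₁ ℚ.* ι) ≡⟨ re Y₂ A₂ Y₁ ι ⟩
      Y₂                                             ∎
      where
      re : ∀ Y₂ A₂ Y₁ ι → Y₂ ℚ.+ (A₂ ℚ.* ι) ℚ.* Y₁ ℚ.+ A₂ ℚ.* (ℚ.- Y₁ ℚ.* ι) ≡ Y₂
      re = solve-∀ ℚ-ring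

lemma13 : (d : ℕ) → RealQuadParam d →
          (β₁ β₂ : K) → InOplus d β₁ → InOplus d β₂ → IsZBasis d β₁ β₂ →
          (a₁ a₂ : ℕ) → .{{_ : NonZero a₁}} → .{{_ : NonZero a₂}} →
          InOplus d (((+ a₂) ·ℤ β₂) ⊕ ((- (+ a₁)) ·ℤ β₁)) →
          (x : K) →
          (InCone3 β₁ β₂ (((+ a₂) ·ℤ β₂) ⊕ ((- (+ a₁)) ·ℤ β₁)) x × InO d x)
          ⇔ (∃[ y₁ ] ∃[ y₂ ] ((+ 0 ℤ.≤ y₂)
                              × (ℤ→ℚ y₂ ℚ.≥ ℚ.- (((+ a₂) / a₁) ℚ.* ℤ→ℚ y₁))
                              × (x ≡ (y₁ ·ℤ β₁) ⊕ (y₂ ·ℤ β₂))))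
lemma13 d _ β₁ β₂ _ _ (β₁∈O , β₂∈O , span , indep) a₁ a₂ _ x = mk⇔ to from
  where
  open Cone β₁ β₂ a₁ a₂
  Coordinates : K → Set
  Coordinates z = ∃[ y₁ ] ∃[ y₂ ] ((+ 0 ℤ.≤ y₂) × (ℤ→ℚ y₂ ℚ.≥ ℚ.- (ρ ℚ.* ℤ→ℚ y₁)) × (z ≡ (y₁ ·ℤ β₁) ⊕ (y₂ ·ℤ β₂)))
  to : InCone3 β₁ β₂ α x × InO d x → Coordinates x
  to (x∈C , x∈O) = y₁ , y₂ , ℤ→ℚ-nonNeg⁻¹ (proj₁ inequalities) , proj₂ inequalities , x≡y
    where
    y₁ = proj₁ (span x x∈O)
    y₂ = proj₁ (proj₂ (span x x∈O))
    x≡y = proj₂ (proj₂ (span x x∈O))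
    inequalities = InCone3⇒coordinates indep (subst (InCone3 β₁ β₂ α) x≡y x∈C)
  from : Coordinates x → InCone3 β₁ β₂ α x × InO d x
  from (y₁ , y₂ , 0≤y₂ , -ρy₁≤y₂ , x≡y) = subst (λ z → InCone3 β₁ β₂ α z × InO d z) (sym x≡y)
    (coordinates⇒InCone3 (ℤ→ℚ-nonNeg 0≤y₂) -ρy₁≤y₂ , InO-lincomb d β₁∈O β₂∈O y₁ y₂)
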